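{- Let $p$ be a prime, $K$ a field of characteristic $p$, $n\geq2$ an integer, $r=n-1$, and $f\in K^\times$. Let $A=K[t]/(t^{p^n})$ with the Hopf algebra structure given by \[ \Delta(t)=t\otimes1+1\otimes t+f\sum_{\ell=1}^{p-1}\frac{1}{\ell!(p-\ell)!}t^{p^{r}\ell}\otimes t^{p^{r}(p-\ell)},\quad \varepsilon(t)=0,\quad \lambda(t)=-t, \] and let $H=\operatorname{Hom}_K(A,K)$ be its linear dual algebra, with multiplication $(\phi\psi)(h)=\operatorname{mult}(\phi\otimes\psi)\Delta(h)$. For $0\le j\le p^n-1$ let $z_j\in H$ be defined by $z_j(t^i)=\delta_{i,j}$. Then $z_{p^{r}}^{p}=f z_{1}$ and $z_{p^{r}}^{p^{2}}=0$.
   Context: $\delta_{i,j}$ is the Kronecker delta. The coefficients $1/(\ell!(p-\ell)!)$, $1\le\ell\le p-1$, are interpreted in $\mathbb{F}_p\subseteq K$. -}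

module Defs where

open import Level using (_⊔_)
open import Data.Nat as ℕ using (ℕ; zero; suc; _∸_; _^_)
open import Data.Nat.Primality using (Prime)
open import Data.Product using (Σ; _×_)
open import Relation.Nullary using (¬_; yes; no)
open import Algebra.Bundles using (CommutativeRing)

IsField : ∀ {c ℓ} → CommutativeRing c ℓ → Set (c ⊔ ℓ)
IsField R = (¬ (1# ≈ 0#)) × (∀ x → ¬ (x ≈ 0#) → Σ Carrier λ y → x * y ≈ 1#)
  where open CommutativeRing R

module _ {c ℓ} (R : CommutativeRing c ℓ) where
  open CommutativeRing R

  fromℕ : ℕ → Carrier
  fromℕ zero = 0#
  fromℕ (suc n) = 1# + fromℕ n

  -- K has characteristic p (given that K is a field and p is prime)
  HasChar : ℕ → Set ℓ
  HasChar p = fromℕ p ≈ 0#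

  δ : ℕ → ℕ → Carrier
  δ i j with i ℕ.≟ j
  ... | yes _ = 1#
  ... | no _ = 0#

  Σ< : ℕ → (ℕ → Carrier) → Carrier
  Σ< zero g = 0#
  Σ< (suc n) g = Σ< n g + g n

  -- Elements of A ⊗ A = K[t]/(t^N) ⊗ K[t]/(t^N) ≅ K[x,y]/(x^N,y^N), N = p^n,
  -- represented by coefficient functions (a , b) ↦ coeff of t^a ⊗ t^b; only
  -- indices a, b < N are ever read.
  AA : Set c
  AA = ℕ → ℕ → Carrier

  oneAA : AA
  oneAA a b = δ a 0 * δ b 0

  -- multiplication in A ⊗ A (coefficients with a,b < N only depend on lower
  -- coefficients, so truncation is automatic)
  mulAA : AA → AA → AA
  mulAA u v a b = Σ< (suc a) λ a₁ → Σ< (suc b) λ b₁ →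
                    u a₁ b₁ * v (a ∸ a₁) (b ∸ b₁)

  powAA : AA → ℕ → AA
  powAA u zero = oneAA
  powAA u (suc k) = mulAA (powAA u k) u

  -- Δ(t) = t⊗1 + 1⊗t + f Σ_{ℓ=1}^{p-1} c_ℓ t^{p^r ℓ} ⊗ t^{p^r (p-ℓ)},
  -- where c_ℓ ∈ K is the element 1/(ℓ!(p-ℓ)!).
  Δt : (p r : ℕ) (f : Carrier) (c : ℕ → Carrier) → AA
  Δt p r f cc a b =
    δ a 1 * δ b 0 + δ a 0 * δ b 1 +
    f * Σ< (p ∸ 1) (λ k → let l = suc k in
          cc l * (δ a (p ^ r ℕ.* l) * δ b (p ^ r ℕ.* (p ∸ l))))

  -- Δ(t^i) = Δ(t)^i  (Δ is an algebra homomorphism)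
  Δpow : (p r : ℕ) (f : Carrier) (c : ℕ → Carrier) → ℕ → AA
  Δpow p r f cc i = powAA (Δt p r f cc) i

  -- H = Hom_K(A, K), an element φ represented by its values φ(t^i), i < N
  H : Set c
  H = ℕ → Carrier

  mulH : (p r : ℕ) (f : Carrier) (c : ℕ → Carrier) → H → H → H
  mulH p r f cc φ ψ i =
    Σ< (p ^ suc r) λ a → Σ< (p ^ suc r) λ b → Δpow p r f cc i a b * (φ a * ψ b)

  -- unit of H is the counit ε: ε(t^i) = δ_{i,0}
  oneH : H
  oneH i = δ i 0

  powH : (p r : ℕ) (f : Carrier) (c : ℕ → Carrier) → H → ℕ → H
  powH p r f cc φ zero = oneH
  powH p r f cc φ (suc k) = mulH p r f cc (powH p r f cc φ k) φ

  z : ℕ → H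
  z j i = δ i j

{-# OPTIONS --safe #-}
module Submission where

-- Write m = p^r, N = p^n, M = (p − 1)m and κ = f/(p − 1)!.  Right multiplication by z_m sends φ to
-- i ↦ Σ_a [t^a ⊗ t^m] Δ(t)^i · φ(t^a).  Only the ℓ = p − 1 summand of Δ(t) has y-degree ≤ m, so this
-- coefficient is that of x^a y^m in (x + y + κ x^M y^m)^i, namely C(i, m) [a + m = i] + κ i [a + 1 = M + i].
-- Hence every power of z_m is a multiple of a single z_s.  For s = q + k m with q < m, one more factor
-- z_m gives (k + 1) z_(s+m) while k < p − 1, because C(q + (k + 1) m, m) ≡ k + 1 (mod p), and it gives
-- κ (q + 1) z_(q+1) when k = p − 1.  From z_0, p steps yield (p − 1)! κ z_1 = f z_1; p rounds of p steps
-- end with the factor κ p = 0.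

open import Defs
open import Algebra.Bundles using (CommutativeRing)
open import Data.Nat as ℕ using (ℕ; zero; suc; _≤_; _<_; _∸_; _^_; _!; z≤n; s≤s)
open import Data.Nat.Properties as ℕ using ()
open import Data.Nat.Combinatorics using (_C_; nC1≡n; nCn≡1; k>n⇒nCk≡0; nCk+nC[k+1]≡[n+1]C[k+1])
open import Data.Nat.Divisibility using (_∣_; divides; _∣?_; ∣-refl; ∣-trans; 1∣_; m∣m*n; *-monoʳ-∣; *-cancelˡ-∣; ∣⇒≤)
open import Data.Nat.Primality using (Prime; euclidsLemma; prime⇒nonZero; prime⇒nonTrivial)
open import Data.Nat.Solver using (module +-*-Solver)
open import Data.Empty using (⊥-elim)
open import Data.Product using (Σ; _×_; _,_; proj₁; proj₂)
open import Data.Sum using (inj₁; inj₂)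
open import Relation.Nullary using (¬_; yes; no)
open import Relation.Binary.PropositionalEquality as ≡ using (_≡_; _≢_)

[1+k]*[1+n]C[1+k]≡[1+n]*nCk : ∀ n k → suc k ℕ.* (suc n C suc k) ≡ suc n ℕ.* (n C k)
[1+k]*[1+n]C[1+k]≡[1+n]*nCk n zero =
  ≡.trans (ℕ.*-identityˡ _) (≡.trans (nC1≡n (suc n)) (≡.sym (ℕ.*-identityʳ (suc n))))
[1+k]*[1+n]C[1+k]≡[1+n]*nCk zero (suc k) = ℕ.*-zeroʳ (suc (suc k))
[1+k]*[1+n]C[1+k]≡[1+n]*nCk (suc n) (suc k) = begin
  (2 ℕ.+ k) ℕ.* (suc (suc n) C (2 ℕ.+ k))
    ≡⟨ ≡.cong ((2 ℕ.+ k) ℕ.*_) (≡.sym (nCk+nC[k+1]≡[n+1]C[k+1] (suc n) (suc k))) ⟩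
  (2 ℕ.+ k) ℕ.* (X ℕ.+ Y)
    ≡⟨ solve 3 (λ k x y → (con 2 :+ k) :* (x :+ y) := x :+ ((con 1 :+ k) :* x :+ (con 2 :+ k) :* y)) ≡.refl k X Y ⟩
  X ℕ.+ ((1 ℕ.+ k) ℕ.* X ℕ.+ (2 ℕ.+ k) ℕ.* Y)
    ≡⟨ ≡.cong₂ (λ u v → X ℕ.+ (u ℕ.+ v)) ([1+k]*[1+n]C[1+k]≡[1+n]*nCk n k) ([1+k]*[1+n]C[1+k]≡[1+n]*nCk n (suc k)) ⟩
  X ℕ.+ ((1 ℕ.+ n) ℕ.* (n C k) ℕ.+ (1 ℕ.+ n) ℕ.* (n C suc k))
    ≡⟨ ≡.cong (X ℕ.+_) (≡.sym (ℕ.*-distribˡ-+ (suc n) (n C k) (n C suc k))) ⟩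
  X ℕ.+ (1 ℕ.+ n) ℕ.* (n C k ℕ.+ n C suc k)
    ≡⟨ ≡.cong (λ u → X ℕ.+ (1 ℕ.+ n) ℕ.* u) (nCk+nC[k+1]≡[n+1]C[k+1] n k) ⟩
  (2 ℕ.+ n) ℕ.* X ∎
  where
  open ≡.≡-Reasoning
  open +-*-Solver
  X Y : ℕ
  X = suc n C suc k
  Y = suc n C suc (suc k)

nC[k∸1]≡[1+n]Ck : ∀ {n k} → k ≡ suc n → n C (k ∸ 1) ≡ suc n C k
nC[k∸1]≡[1+n]Ck {n} ≡.refl = ≡.trans (nCn≡1 n) (≡.sym (nCn≡1 (suc n)))

nC[k∸1]+nCk≡[1+n]Ck : ∀ n {k} → 0 < k → n C (k ∸ 1) ℕ.+ n C k ≡ suc n C k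
nC[k∸1]+nCk≡[1+n]Ck n {suc k} _ = nCk+nC[k+1]≡[n+1]C[k+1] n k

m∣j*mCj : ∀ m j → 0 < j → m ∣ j ℕ.* (m C j)
m∣j*mCj zero    j@(suc _) _ = ≡.subst (0 ∣_) (≡.sym (ℕ.*-zeroʳ j)) ∣-refl
m∣j*mCj (suc n) (suc k)   _ =
  divides (n C k) (≡.trans ([1+k]*[1+n]C[1+k]≡[1+n]*nCk n k) (ℕ.*-comm (suc n) (n C k)))

p^e∣j*x⇒p^e∣j : ∀ {p x} → Prime p → ¬ p ∣ x → ∀ e j → p ^ e ∣ j ℕ.* x → p ^ e ∣ j
p^e∣j*x⇒p^e∣j pp p∤x zero j _ = 1∣ j
p^e∣j*x⇒p^e∣j {p} {x} pp p∤x (suc e) j p^[1+e]∣jx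
  with euclidsLemma j x pp (∣-trans (m∣m*n (p ^ e)) p^[1+e]∣jx)
... | inj₂ p∣x = ⊥-elim (p∤x p∣x)
... | inj₁ (divides q ≡.refl) = ≡.subst (p ℕ.* p ^ e ∣_) (ℕ.*-comm p q) (*-monoʳ-∣ p p^e∣q)
  where
  instance
    p-nonZero : ℕ.NonZero p
    p-nonZero = prime⇒nonZero pp
  p^e∣q : p ^ e ∣ q
  p^e∣q = p^e∣j*x⇒p^e∣j pp p∤x e q (*-cancelˡ-∣ p
    (≡.subst (p ℕ.* p ^ e ∣_) (≡.trans (≡.cong (ℕ._* x) (ℕ.*-comm q p)) (ℕ.*-assoc p q x)) p^[1+e]∣jx))

-- j C(p^e, j) = p^e C(p^e − 1, j − 1), while p^e ∤ j.
p∣[p^e]Cj : ∀ {p} → Prime p → ∀ e j → 0 < j → j < p ^ e → p ∣ (p ^ e) C j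
p∣[p^e]Cj {p} pp e j 0<j j<p^e with p ∣? (p ^ e) C j
... | yes p∣C = p∣C
... | no p∤C  = ⊥-elim (ℕ.<⇒≱ j<p^e (∣⇒≤ {{ℕ.>-nonZero 0<j}} (p^e∣j*x⇒p^e∣j pp p∤C e j (m∣j*mCj (p ^ e) j 0<j))))

module _ {c ℓ} (K : CommutativeRing c ℓ) where
  open CommutativeRing K
  open import Relation.Binary.Reasoning.Setoid setoid
  open import Algebra.Properties.CommutativeSemigroup +-commutativeSemigroup
    using () renaming (interchange to +-interchange)
  open import Algebra.Properties.CommutativeSemigroup *-commutativeSemigroup
    using (x∙yz≈xz∙y; x∙yz≈y∙xz)
  open import Algebra.Solver.Ring.NaturalCoefficients.Default commutativeSemiring

  fromℕ-+ : ∀ a b → fromℕ K (a ℕ.+ b) ≈ fromℕ K a + fromℕ K b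
  fromℕ-+ zero    b = sym (+-identityˡ _)
  fromℕ-+ (suc a) b = trans (+-congˡ (fromℕ-+ a b)) (sym (+-assoc _ _ _))

  fromℕ-* : ∀ a b → fromℕ K (a ℕ.* b) ≈ fromℕ K a * fromℕ K b
  fromℕ-* zero    b = sym (zeroˡ _)
  fromℕ-* (suc a) b = begin
    fromℕ K (b ℕ.+ a ℕ.* b)            ≈⟨ fromℕ-+ b (a ℕ.* b) ⟩
    fromℕ K b + fromℕ K (a ℕ.* b)      ≈⟨ +-congˡ (fromℕ-* a b) ⟩
    fromℕ K b + fromℕ K a * fromℕ K b  ≈⟨ +-congʳ (sym (*-identityˡ _)) ⟩
    1# * fromℕ K b + fromℕ K a * fromℕ K b ≈⟨ sym (distribʳ _ _ _) ⟩
    (1# + fromℕ K a) * fromℕ K b       ∎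

  δ-≡ : ∀ {i j} → i ≡ j → δ K i j ≈ 1#
  δ-≡ {i} {j} i≡j with i ℕ.≟ j
  ... | yes _  = refl
  ... | no i≢j = ⊥-elim (i≢j i≡j)

  δ-≢ : ∀ {i j} → i ≢ j → δ K i j ≈ 0#
  δ-≢ {i} {j} i≢j with i ℕ.≟ j
  ... | yes i≡j = ⊥-elim (i≢j i≡j)
  ... | no _    = refl

  δ-cong : ∀ {i j k l} → (i ≡ j → k ≡ l) → (k ≡ l → i ≡ j) → δ K i j ≈ δ K k l
  δ-cong {i} {j} to from with i ℕ.≟ j
  ... | yes i≡j = sym (δ-≡ (to i≡j))
  ... | no i≢j  = sym (δ-≢ (λ k≡l → i≢j (from k≡l)))

  δ-suc : ∀ i j → δ K (suc i) (suc j) ≈ δ K i j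
  δ-suc i j = δ-cong {suc i} {suc j} ℕ.suc-injective (≡.cong suc)

  *-δ-congʳ : ∀ {i j x y} → (i ≡ j → x ≈ y) → x * δ K i j ≈ y * δ K i j
  *-δ-congʳ {i} {j} x≈y with i ℕ.≟ j
  ... | yes i≡j = *-congʳ (x≈y i≡j)
  ... | no _    = trans (zeroʳ _) (sym (zeroʳ _))

  *-δ-≢ : ∀ {i j} x → i ≢ j → x * δ K i j ≈ 0#
  *-δ-≢ x i≢j = trans (*-congˡ (δ-≢ i≢j)) (zeroʳ x)

  Σ<-cong : ∀ n {g h} → (∀ j → j < n → g j ≈ h j) → Σ< K n g ≈ Σ< K n h
  Σ<-cong zero    g≈h = refl
  Σ<-cong (suc n) g≈h = +-cong (Σ<-cong n (λ j j<n → g≈h j (ℕ.m<n⇒m<1+n j<n))) (g≈h n ℕ.≤-refl)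

  Σ<-zero : ∀ n {g} → (∀ j → j < n → g j ≈ 0#) → Σ< K n g ≈ 0#
  Σ<-zero zero    g≈0 = refl
  Σ<-zero (suc n) g≈0 =
    trans (+-cong (Σ<-zero n (λ j j<n → g≈0 j (ℕ.m<n⇒m<1+n j<n))) (g≈0 n ℕ.≤-refl)) (+-identityˡ 0#)

  Σ<-+ : ∀ n (g h : ℕ → Carrier) → Σ< K n (λ j → g j + h j) ≈ Σ< K n g + Σ< K n h
  Σ<-+ zero    g h = sym (+-identityˡ 0#)
  Σ<-+ (suc n) g h = trans (+-congʳ (Σ<-+ n g h)) (+-interchange _ _ _ _)

  Σ<-*ˡ : ∀ n x (g : ℕ → Carrier) → Σ< K n (λ j → x * g j) ≈ x * Σ< K n g
  Σ<-*ˡ zero    x g = sym (zeroʳ x)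
  Σ<-*ˡ (suc n) x g = trans (+-congʳ (Σ<-*ˡ n x g)) (sym (distribˡ x _ _))

  Σ<-*ʳ : ∀ n x (g : ℕ → Carrier) → Σ< K n (λ j → g j * x) ≈ Σ< K n g * x
  Σ<-*ʳ zero    x g = sym (zeroˡ x)
  Σ<-*ʳ (suc n) x g = trans (+-congʳ (Σ<-*ʳ n x g)) (sym (distribʳ x _ _))

  Σ<-δ : ∀ n {s} (g : ℕ → Carrier) → s < n → Σ< K n (λ j → g j * δ K j s) ≈ g s
  Σ<-δ (suc n) {s} g s<1+n with ℕ.m≤n⇒m<n∨m≡n (ℕ.≤-pred s<1+n)
  ... | inj₁ s<n    = trans (+-cong (Σ<-δ n g s<n) (*-δ-≢ (g n) (ℕ.>⇒≢ s<n))) (+-identityʳ (g s))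
  ... | inj₂ ≡.refl = trans (+-cong (Σ<-zero n {λ j → g j * δ K j n} λ j j<n → *-δ-≢ (g j) (ℕ.<⇒≢ j<n)) (*-congˡ (δ-≡ {n} ≡.refl)))
                            (trans (+-identityˡ _) (*-identityʳ (g s)))

  Σ<-δ-∸ : ∀ a {X} (g : ℕ → Carrier) → X ≤ a → Σ< K (suc a) (λ j → g j * δ K (a ∸ j) X) ≈ g (a ∸ X)
  Σ<-δ-∸ a {X} g X≤a = trans (Σ<-cong (suc a) λ j j<1+a → *-congˡ (δ-cong (to (ℕ.≤-pred j<1+a)) from))
                              (Σ<-δ (suc a) g (s≤s (ℕ.m∸n≤m a X)))
    where
    to : ∀ {j} → j ≤ a → a ∸ j ≡ X → j ≡ a ∸ X
    to j≤a ≡.refl = ≡.sym (ℕ.m∸[m∸n]≡n j≤a)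
    from : ∀ {j} → j ≡ a ∸ X → a ∸ j ≡ X
    from ≡.refl = ℕ.m∸[m∸n]≡n X≤a

  Σ<-δ-∸-< : ∀ a {X} (g : ℕ → Carrier) → a < X → Σ< K (suc a) (λ j → g j * δ K (a ∸ j) X) ≈ 0#
  Σ<-δ-∸-< a g a<X = Σ<-zero (suc a) λ j _ → *-δ-≢ (g j) (ℕ.<⇒≢ (ℕ.≤-<-trans (ℕ.m∸n≤m a j) a<X))

  monomial : ℕ → ℕ → AA K
  monomial X Y a b = δ K a X * δ K b Y

  mulAA-congʳ : ∀ u {v w} a b → (∀ x y → y ≤ b → v x y ≈ w x y) → mulAA K u v a b ≈ mulAA K u w a b
  mulAA-congʳ u a b v≈w = Σ<-cong (suc a) λ a₁ _ → Σ<-cong (suc b) λ b₁ _ → *-congˡ (v≈w _ _ (ℕ.m∸n≤m b b₁))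

  mulAA-+ʳ : ∀ u v w a b → mulAA K u (λ x y → v x y + w x y) a b ≈ mulAA K u v a b + mulAA K u w a b
  mulAA-+ʳ u v w a b = trans (Σ<-cong (suc a) λ a₁ _ → trans (Σ<-cong (suc b) λ b₁ _ → distribˡ _ _ _) (Σ<-+ (suc b) _ _))
                             (Σ<-+ (suc a) _ _)

  mulAA-*ʳ : ∀ u κ v a b → mulAA K u (λ x y → κ * v x y) a b ≈ κ * mulAA K u v a b
  mulAA-*ʳ u κ v a b = trans (Σ<-cong (suc a) λ a₁ _ → trans (Σ<-cong (suc b) λ b₁ _ → x∙yz≈y∙xz _ κ _) (Σ<-*ˡ (suc b) κ _))
                             (Σ<-*ˡ (suc a) κ _)

  private
    mulAA-monomial-by-rows : ∀ u X Y a b → mulAA K u (monomial X Y) a b ≈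
      Σ< K (suc a) (λ a₁ → Σ< K (suc b) (λ b₁ → u a₁ b₁ * δ K (b ∸ b₁) Y) * δ K (a ∸ a₁) X)
    mulAA-monomial-by-rows u X Y a b =
      Σ<-cong (suc a) λ a₁ _ → trans (Σ<-cong (suc b) λ b₁ _ → x∙yz≈xz∙y _ _ _) (Σ<-*ʳ (suc b) _ _)

  mulAA-monomial : ∀ u X Y {a b} → X ≤ a → Y ≤ b → mulAA K u (monomial X Y) a b ≈ u (a ∸ X) (b ∸ Y)
  mulAA-monomial u X Y {a} {b} X≤a Y≤b = trans (mulAA-monomial-by-rows u X Y a b)
    (trans (Σ<-cong (suc a) λ a₁ _ → *-congʳ (Σ<-δ-∸ b (u a₁) Y≤b)) (Σ<-δ-∸ a (λ a₁ → u a₁ (b ∸ Y)) X≤a))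

  mulAA-monomial-<ˡ : ∀ u X Y {a b} → a < X → mulAA K u (monomial X Y) a b ≈ 0#
  mulAA-monomial-<ˡ u X Y {a} {b} a<X = trans (mulAA-monomial-by-rows u X Y a b) (Σ<-δ-∸-< a _ a<X)

  mulAA-monomial-<ʳ : ∀ u X Y {a b} → b < Y → mulAA K u (monomial X Y) a b ≈ 0#
  mulAA-monomial-<ʳ u X Y {a} {b} b<Y = trans (mulAA-monomial-by-rows u X Y a b)
    (Σ<-zero (suc a) λ a₁ _ → trans (*-congʳ (Σ<-δ-∸-< b (u a₁) b<Y)) (zeroˡ _))

  module Trinomial {m M : ℕ} (0<m : 0 < m) (0<M : 0 < M) (κ : Carrier) (Δ : AA K)
    (Δ-trunc : ∀ x y → y ≤ m → Δ x y ≈ monomial 1 0 x y + monomial 0 1 x y + κ * monomial M m x y) where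

    private
      P : ℕ → AA K
      P = powAA K Δ

      instance
        m-nonZero : ℕ.NonZero m
        m-nonZero = ℕ.>-nonZero 0<m

      1+[m∸1]≡m : suc (m ∸ 1) ≡ m
      1+[m∸1]≡m = ℕ.suc-pred m

      m∸1<m : m ∸ 1 < m
      m∸1<m = ℕ.≤-reflexive 1+[m∸1]≡m

    powAA-suc : ∀ i a b → b ≤ m → P (suc i) a b ≈
      mulAA K (P i) (monomial 1 0) a b + mulAA K (P i) (monomial 0 1) a b + κ * mulAA K (P i) (monomial M m) a b
    powAA-suc i a b b≤m = begin
      mulAA K (P i) Δ a b
        ≈⟨ mulAA-congʳ (P i) a b (λ x y y≤b → Δ-trunc x y (ℕ.≤-trans y≤b b≤m)) ⟩
      mulAA K (P i) (λ x y → monomial 1 0 x y + monomial 0 1 x y + κ * monomial M m x y) a b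
        ≈⟨ mulAA-+ʳ (P i) (λ x y → monomial 1 0 x y + monomial 0 1 x y) (λ x y → κ * monomial M m x y) a b ⟩
      mulAA K (P i) (λ x y → monomial 1 0 x y + monomial 0 1 x y) a b + mulAA K (P i) (λ x y → κ * monomial M m x y) a b
        ≈⟨ +-cong (mulAA-+ʳ (P i) (monomial 1 0) (monomial 0 1) a b) (mulAA-*ʳ (P i) κ (monomial M m) a b) ⟩
      mulAA K (P i) (monomial 1 0) a b + mulAA K (P i) (monomial 0 1) a b + κ * mulAA K (P i) (monomial M m) a b ∎

    powAA-suc-below : ∀ i a b → b < m → P (suc i) a b ≈
      mulAA K (P i) (monomial 1 0) a b + mulAA K (P i) (monomial 0 1) a b
    powAA-suc-below i a b b<m = trans (powAA-suc i a b (ℕ.<⇒≤ b<m))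
      (trans (+-congˡ (trans (*-congˡ (mulAA-monomial-<ʳ (P i) M m b<m)) (zeroʳ κ))) (+-identityʳ _))

    powAA-below : ∀ i a b → b < m → P i a b ≈ fromℕ K (i C b) * δ K (a ℕ.+ b) i
    powAA-below zero a zero _ = begin
      δ K a 0 * 1#            ≈⟨ *-identityʳ _ ⟩
      δ K a 0                 ≈⟨ reflexive (≡.cong (λ x → δ K x 0) (≡.sym (ℕ.+-identityʳ a))) ⟩
      δ K (a ℕ.+ 0) 0         ≈⟨ sym (*-identityˡ _) ⟩
      1# * δ K (a ℕ.+ 0) 0    ≈⟨ *-congʳ (sym (+-identityʳ 1#)) ⟩
      fromℕ K 1 * δ K (a ℕ.+ 0) 0 ∎
    powAA-below zero a (suc b) _ = trans (zeroʳ _) (sym (zeroˡ _))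
    powAA-below (suc i) zero zero b<m = begin
      P (suc i) 0 0
        ≈⟨ trans (powAA-suc-below i 0 0 b<m)
            (+-cong (mulAA-monomial-<ˡ (P i) 1 0 (s≤s z≤n)) (mulAA-monomial-<ʳ (P i) 0 1 (s≤s z≤n))) ⟩
      0# + 0#                       ≈⟨ +-identityʳ 0# ⟩
      0#                            ≈⟨ sym (zeroʳ _) ⟩
      fromℕ K 1 * δ K 0 (suc i)     ∎
    powAA-below (suc i) (suc a) zero b<m = begin
      P (suc i) (suc a) 0
        ≈⟨ trans (powAA-suc-below i (suc a) 0 b<m)
            (+-cong (mulAA-monomial (P i) 1 0 (s≤s z≤n) z≤n) (mulAA-monomial-<ʳ (P i) 0 1 (s≤s z≤n))) ⟩
      P i a 0 + 0#                  ≈⟨ +-identityʳ _ ⟩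
      P i a 0                       ≈⟨ powAA-below i a 0 b<m ⟩
      fromℕ K 1 * δ K (a ℕ.+ 0) i   ≈⟨ *-congˡ (sym (δ-suc (a ℕ.+ 0) i)) ⟩
      fromℕ K 1 * δ K (suc a ℕ.+ 0) (suc i) ∎
    powAA-below (suc i) zero (suc b) b<m = begin
      P (suc i) 0 (suc b)
        ≈⟨ trans (powAA-suc-below i 0 (suc b) b<m)
            (+-cong (mulAA-monomial-<ˡ (P i) 1 0 (s≤s z≤n)) (mulAA-monomial (P i) 0 1 z≤n (s≤s z≤n))) ⟩
      0# + P i 0 b                  ≈⟨ +-identityˡ _ ⟩
      P i 0 b                       ≈⟨ powAA-below i 0 b (ℕ.<-trans (ℕ.n<1+n b) b<m) ⟩
      fromℕ K (i C b) * δ K b i     ≈⟨ *-congˡ (sym (δ-suc b i)) ⟩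
      fromℕ K (i C b) * δ K (suc b) (suc i)
        ≈⟨ *-δ-congʳ {suc b} {suc i} (λ 1+b≡1+i → reflexive (≡.cong (fromℕ K) (nC[k∸1]≡[1+n]Ck {i} 1+b≡1+i))) ⟩
      fromℕ K (suc i C suc b) * δ K (suc b) (suc i) ∎
    powAA-below (suc i) (suc a) (suc b) b<m = begin
      P (suc i) (suc a) (suc b)
        ≈⟨ trans (powAA-suc-below i (suc a) (suc b) b<m)
            (+-cong (mulAA-monomial (P i) 1 0 (s≤s z≤n) z≤n) (mulAA-monomial (P i) 0 1 z≤n (s≤s z≤n))) ⟩
      P i a (suc b) + P i (suc a) b ≈⟨ +-cong (powAA-below i a (suc b) b<m) (powAA-below i (suc a) b (ℕ.<-trans (ℕ.n<1+n b) b<m)) ⟩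
      fromℕ K (i C suc b) * δ K (a ℕ.+ suc b) i + fromℕ K (i C b) * δ K (suc a ℕ.+ b) i
        ≈⟨ +-congˡ (*-congˡ (reflexive (≡.cong (λ x → δ K x i) (≡.sym (ℕ.+-suc a b))))) ⟩
      fromℕ K (i C suc b) * δ K (a ℕ.+ suc b) i + fromℕ K (i C b) * δ K (a ℕ.+ suc b) i
        ≈⟨ trans (sym (distribʳ _ _ _)) (*-congʳ (+-comm _ _)) ⟩
      (fromℕ K (i C b) + fromℕ K (i C suc b)) * δ K (a ℕ.+ suc b) i
        ≈⟨ *-cong (trans (sym (fromℕ-+ (i C b) (i C suc b))) (reflexive (≡.cong (fromℕ K) (nCk+nC[k+1]≡[n+1]C[k+1] i b))))
                  (sym (δ-suc (a ℕ.+ suc b) i)) ⟩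
      fromℕ K (suc i C suc b) * δ K (suc a ℕ.+ suc b) (suc i) ∎

    mulAA-powAA-monomial-M-m : ∀ i a → mulAA K (P i) (monomial M m) a m ≈ δ K a (M ℕ.+ i)
    mulAA-powAA-monomial-M-m i a with M ℕ.≤? a
    ... | yes M≤a = begin
      mulAA K (P i) (monomial M m) a m  ≈⟨ mulAA-monomial (P i) M m M≤a ℕ.≤-refl ⟩
      P i (a ∸ M) (m ∸ m)               ≈⟨ reflexive (≡.cong (P i (a ∸ M)) (ℕ.n∸n≡0 m)) ⟩
      P i (a ∸ M) 0                     ≈⟨ powAA-below i (a ∸ M) 0 0<m ⟩
      fromℕ K 1 * δ K (a ∸ M ℕ.+ 0) i   ≈⟨ trans (*-congʳ (+-identityʳ 1#)) (*-identityˡ _) ⟩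
      δ K (a ∸ M ℕ.+ 0) i               ≈⟨ δ-cong to from ⟩
      δ K a (M ℕ.+ i)                   ∎
      where
      to : a ∸ M ℕ.+ 0 ≡ i → a ≡ M ℕ.+ i
      to ≡.refl = ≡.trans (≡.sym (ℕ.m+[n∸m]≡n M≤a)) (≡.cong (M ℕ.+_) (≡.sym (ℕ.+-identityʳ (a ∸ M))))
      from : a ≡ M ℕ.+ i → a ∸ M ℕ.+ 0 ≡ i
      from ≡.refl = ≡.trans (ℕ.+-identityʳ _) (ℕ.m+n∸m≡n M i)
    ... | no M≰a = trans (mulAA-monomial-<ˡ (P i) M m (ℕ.≰⇒> M≰a))
                         (sym (δ-≢ λ a≡M+i → M≰a (ℕ.≤-trans (ℕ.m≤m+n M i) (ℕ.≤-reflexive (≡.sym a≡M+i)))))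

    -- δ (suc a) (M + i) encodes a = M + i − 1 without truncated subtraction; at i = 0 the factor i is 0.
    powAA-at-m : ∀ i a → P i a m ≈ fromℕ K (i C m) * δ K (a ℕ.+ m) i + κ * (fromℕ K i * δ K (suc a) (M ℕ.+ i))
    powAA-at-m zero a = begin
      δ K a 0 * δ K m 0  ≈⟨ *-δ-≢ _ (ℕ.>⇒≢ 0<m) ⟩
      0#                 ≈⟨ sym (trans (+-cong (trans (*-congʳ 0Cm≈0) (zeroˡ _)) (trans (*-congˡ (zeroˡ _)) (zeroʳ κ)))
                                       (+-identityʳ 0#)) ⟩
      fromℕ K (0 C m) * δ K (a ℕ.+ m) 0 + κ * (0# * δ K (suc a) (M ℕ.+ 0)) ∎
      where
      0Cm≈0 : fromℕ K (0 C m) ≈ 0#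
      0Cm≈0 = reflexive (≡.cong (fromℕ K) (k>n⇒nCk≡0 0<m))
    powAA-at-m (suc i) zero = begin
      P (suc i) 0 m
        ≈⟨ trans (powAA-suc i 0 m ℕ.≤-refl)
             (+-cong (+-cong (mulAA-monomial-<ˡ (P i) 1 0 (s≤s z≤n)) (mulAA-monomial (P i) 0 1 z≤n 0<m))
                     (*-congˡ (mulAA-monomial-<ˡ (P i) M m 0<M))) ⟩
      0# + P i 0 (m ∸ 1) + κ * 0#
        ≈⟨ trans (+-congˡ (zeroʳ κ)) (trans (+-identityʳ _) (+-identityˡ _)) ⟩
      P i 0 (m ∸ 1)                           ≈⟨ powAA-below i 0 (m ∸ 1) m∸1<m ⟩
      fromℕ K (i C (m ∸ 1)) * δ K (m ∸ 1) i
        ≈⟨ *-congˡ (δ-cong (λ e → ≡.trans (≡.sym 1+[m∸1]≡m) (≡.cong suc e)) (≡.cong (_∸ 1))) ⟩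
      fromℕ K (i C (m ∸ 1)) * δ K m (suc i)
        ≈⟨ *-δ-congʳ {m} {suc i} (λ e → reflexive (≡.cong (fromℕ K) (nC[k∸1]≡[1+n]Ck {i} e))) ⟩
      fromℕ K (suc i C m) * δ K m (suc i)
        ≈⟨ sym (trans (+-congˡ (trans (*-congˡ (*-δ-≢ _ 1≢M+1+i)) (zeroʳ κ))) (+-identityʳ _)) ⟩
      fromℕ K (suc i C m) * δ K (0 ℕ.+ m) (suc i) + κ * (fromℕ K (suc i) * δ K 1 (M ℕ.+ suc i)) ∎
      where
      1≢M+1+i : 1 ≢ M ℕ.+ suc i
      1≢M+1+i = ℕ.<⇒≢ (≡.subst (1 <_) (≡.sym (ℕ.+-suc M i)) (s≤s (ℕ.≤-trans 0<M (ℕ.m≤m+n M i))))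
    powAA-at-m (suc i) (suc a) = begin
      P (suc i) (suc a) m
        ≈⟨ trans (powAA-suc i (suc a) m ℕ.≤-refl)
             (+-cong (+-cong (mulAA-monomial (P i) 1 0 (s≤s z≤n) z≤n) (mulAA-monomial (P i) 0 1 z≤n 0<m))
                     (*-congˡ (mulAA-powAA-monomial-M-m i (suc a)))) ⟩
      P i a m + P i (suc a) (m ∸ 1) + κ * e
        ≈⟨ +-congʳ (+-cong (powAA-at-m i a) (trans (powAA-below i (suc a) (m ∸ 1) m∸1<m) (*-congˡ (reflexive (≡.cong (λ x → δ K x i) 1+a+[m∸1]≡a+m))))) ⟩
      (A * d + κ * (I * e)) + B * d + κ * e
        ≈⟨ solve 6 (λ A B I κ d e → (A :* d :+ κ :* (I :* e)) :+ B :* d :+ κ :* e := (B :+ A) :* d :+ κ :* ((con 1 :+ I) :* e)) refl A B I κ d e ⟩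
      (B + A) * d + κ * ((1# + I) * e)
        ≈⟨ +-cong (*-cong (trans (sym (fromℕ-+ (i C (m ∸ 1)) (i C m))) (reflexive (≡.cong (fromℕ K) (nC[k∸1]+nCk≡[1+n]Ck i 0<m))))
                          (sym (δ-suc (a ℕ.+ m) i)))
                  (*-congˡ (*-congˡ (δ-cong (λ e → ≡.trans (≡.cong suc e) (≡.sym (ℕ.+-suc M i))) (λ e → ℕ.suc-injective (≡.trans e (ℕ.+-suc M i)))))) ⟩
      fromℕ K (suc i C m) * δ K (suc a ℕ.+ m) (suc i) + κ * (fromℕ K (suc i) * δ K (suc (suc a)) (M ℕ.+ suc i)) ∎
      where
      A B I d e : Carrier
      A = fromℕ K (i C m)
      B = fromℕ K (i C (m ∸ 1))
      I = fromℕ K i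
      d = δ K (a ℕ.+ m) i
      e = δ K (suc a) (M ℕ.+ i)
      1+a+[m∸1]≡a+m : suc a ℕ.+ (m ∸ 1) ≡ a ℕ.+ m
      1+a+[m∸1]≡a+m = ≡.trans (≡.sym (ℕ.+-suc a (m ∸ 1))) (≡.cong (a ℕ.+_) 1+[m∸1]≡m)

  module _ {p} (p-prime : Prime p) (char-p : HasChar K p) where

    fromℕ-∣ : ∀ {x} → p ∣ x → fromℕ K x ≈ 0#
    fromℕ-∣ (divides q ≡.refl) = trans (fromℕ-* q p) (trans (*-congˡ char-p) (zeroʳ _))

    module _ (e : ℕ) where
      private
        m : ℕ
        m = p ^ e
        instance
          p-nonZero : ℕ.NonZero p
          p-nonZero = prime⇒nonZero p-prime
        0<m : 0 < m
        0<m = ℕ.m^n>0 p e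

      -- Allowing q = p^e lets the induction on q carry over from j to j + 1.
      fromℕ-[q+j*p^e]Cb : ∀ j q → q ≤ m → ∀ b → b ≤ m →
        fromℕ K ((q ℕ.+ j ℕ.* m) C b) ≈ fromℕ K (q C b) + fromℕ K j * δ K b m
      fromℕ-[q+j*p^e]Cb zero zero _ b _ = sym (trans (+-congˡ (zeroˡ _)) (+-identityʳ _))
      fromℕ-[q+j*p^e]Cb (suc j) zero _ b b≤m = trans (fromℕ-[q+j*p^e]Cb j m ℕ.≤-refl b b≤m) (wrap b b≤m)
        where
        wrap : ∀ b → b ≤ m → fromℕ K (m C b) + fromℕ K j * δ K b m ≈ fromℕ K (0 C b) + fromℕ K (suc j) * δ K b m
        wrap b b≤m with ℕ.m≤n⇒m<n∨m≡n b≤m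
        ... | inj₂ ≡.refl = begin
          fromℕ K (m C m) + fromℕ K j * δ K m m   ≈⟨ +-cong (reflexive (≡.cong (fromℕ K) (nCn≡1 m))) (*-congˡ (δ-≡ {m} ≡.refl)) ⟩
          (1# + 0#) + fromℕ K j * 1#              ≈⟨ trans (+-cong (+-identityʳ 1#) (*-identityʳ _)) (sym (+-identityˡ _)) ⟩
          0# + (1# + fromℕ K j)                   ≈⟨ +-cong (reflexive (≡.cong (fromℕ K) (≡.sym (k>n⇒nCk≡0 0<m)))) (sym (*-identityʳ _)) ⟩
          fromℕ K (0 C m) + fromℕ K (suc j) * 1#  ≈⟨ +-congˡ (*-congˡ (sym (δ-≡ {m} ≡.refl))) ⟩
          fromℕ K (0 C m) + fromℕ K (suc j) * δ K m m ∎
        ... | inj₁ b<m = +-cong (mCb≈0Cb b b<m) (trans (*-δ-≢ _ (ℕ.<⇒≢ b<m)) (sym (*-δ-≢ _ (ℕ.<⇒≢ b<m))))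
          where
          mCb≈0Cb : ∀ b → b < m → fromℕ K (m C b) ≈ fromℕ K (0 C b)
          mCb≈0Cb zero    _   = refl
          mCb≈0Cb (suc b) b<m = fromℕ-∣ (p∣[p^e]Cj p-prime e (suc b) (s≤s z≤n) b<m)
      fromℕ-[q+j*p^e]Cb j (suc q) _ zero _ = sym (trans (+-congˡ (*-δ-≢ _ (ℕ.<⇒≢ 0<m))) (+-identityʳ _))
      fromℕ-[q+j*p^e]Cb j (suc q) 1+q≤m (suc b) 1+b≤m = begin
        fromℕ K (suc (q ℕ.+ j ℕ.* m) C suc b)
          ≈⟨ reflexive (≡.cong (fromℕ K) (≡.sym (nCk+nC[k+1]≡[n+1]C[k+1] (q ℕ.+ j ℕ.* m) b))) ⟩
        fromℕ K ((q ℕ.+ j ℕ.* m) C b ℕ.+ (q ℕ.+ j ℕ.* m) C suc b)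
          ≈⟨ fromℕ-+ ((q ℕ.+ j ℕ.* m) C b) ((q ℕ.+ j ℕ.* m) C suc b) ⟩
        fromℕ K ((q ℕ.+ j ℕ.* m) C b) + fromℕ K ((q ℕ.+ j ℕ.* m) C suc b)
          ≈⟨ +-cong (fromℕ-[q+j*p^e]Cb j q q≤m b b≤m) (fromℕ-[q+j*p^e]Cb j q q≤m (suc b) 1+b≤m) ⟩
        (fromℕ K (q C b) + fromℕ K j * δ K b m) + (fromℕ K (q C suc b) + fromℕ K j * δ K (suc b) m)
          ≈⟨ +-congʳ (trans (+-congˡ (*-δ-≢ _ (ℕ.<⇒≢ 1+b≤m))) (+-identityʳ _)) ⟩
        fromℕ K (q C b) + (fromℕ K (q C suc b) + fromℕ K j * δ K (suc b) m)
          ≈⟨ sym (+-assoc _ _ _) ⟩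
        (fromℕ K (q C b) + fromℕ K (q C suc b)) + fromℕ K j * δ K (suc b) m
          ≈⟨ +-congʳ (trans (sym (fromℕ-+ (q C b) (q C suc b))) (reflexive (≡.cong (fromℕ K) (nCk+nC[k+1]≡[n+1]C[k+1] q b)))) ⟩
        fromℕ K (suc q C suc b) + fromℕ K j * δ K (suc b) m ∎
        where
        q≤m = ℕ.<⇒≤ 1+q≤m
        b≤m = ℕ.<⇒≤ 1+b≤m

      fromℕ-[q+j*p^e]Cp^e : ∀ j q → q < m → fromℕ K ((q ℕ.+ j ℕ.* m) C m) ≈ fromℕ K j
      fromℕ-[q+j*p^e]Cp^e j q q<m = begin
        fromℕ K ((q ℕ.+ j ℕ.* m) C m)           ≈⟨ fromℕ-[q+j*p^e]Cb j q (ℕ.<⇒≤ q<m) m ℕ.≤-refl ⟩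
        fromℕ K (q C m) + fromℕ K j * δ K m m   ≈⟨ +-cong (reflexive (≡.cong (fromℕ K) (k>n⇒nCk≡0 q<m))) (*-congˡ (δ-≡ {m} ≡.refl)) ⟩
        0# + fromℕ K j * 1#                     ≈⟨ trans (+-identityˡ _) (*-identityʳ _) ⟩
        fromℕ K j                               ∎

  module PowersOfZ (p₁ r₁ : ℕ) (f : Carrier) (cf : ℕ → Carrier)
    (p-prime : Prime (suc (suc p₁))) (char-p : HasChar K (suc (suc p₁)))
    (cf-top : cf (suc p₁) * fromℕ K (suc p₁ !) ≈ 1#) where

    p r m M N : ℕ
    p = suc (suc p₁)
    r = suc r₁
    m = p ^ r
    M = m ℕ.* suc p₁
    N = p ^ suc r

    κ : Carrier
    κ = f * cf (suc p₁)

    0<m : 0 < m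
    0<m = ℕ.m^n>0 p r

    0<M : 0 < M
    0<M = ℕ.<-≤-trans 0<m (ℕ.m≤m*n m (suc p₁))

    p≤m : p ≤ m
    p≤m = ℕ.m≤m*n p (p ^ r₁) {{ℕ.>-nonZero (ℕ.m^n>0 p r₁)}}

    m<N : m < N
    m<N = ≡.subst (m <_) (ℕ.*-comm m p) (ℕ.m<m*n m p {{ℕ.>-nonZero 0<m}} (s≤s (s≤s z≤n)))

    M+m≡N : M ℕ.+ m ≡ N
    M+m≡N = ≡.trans (ℕ.+-comm M m) (≡.cong (m ℕ.+_) (ℕ.*-comm m (suc p₁)))

    Δt-trunc : ∀ x y → y ≤ m → Δt K p r f cf x y ≈ monomial 1 0 x y + monomial 0 1 x y + κ * monomial M m x y
    Δt-trunc x y y≤m = +-congˡ (begin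
      f * (Σ< K p₁ term + term p₁)  ≈⟨ *-congˡ (+-cong (Σ<-zero p₁ term≈0) (*-congˡ (*-congˡ (reflexive (≡.cong (δ K y) m*[p∸[1+p₁]]≡m))))) ⟩
      f * (0# + cf (suc p₁) * monomial M m x y) ≈⟨ trans (*-congˡ (+-identityˡ _)) (sym (*-assoc _ _ _)) ⟩
      κ * monomial M m x y ∎)
      where
      term : ℕ → Carrier
      term k = cf (suc k) * (δ K x (m ℕ.* suc k) * δ K y (m ℕ.* (p ∸ suc k)))
      m*[p∸[1+p₁]]≡m : m ℕ.* (p ∸ suc p₁) ≡ m
      m*[p∸[1+p₁]]≡m = ≡.trans (≡.cong (m ℕ.*_) (ℕ.m+n∸n≡m 1 (suc p₁))) (ℕ.*-identityʳ m)
      term≈0 : ∀ k → k < p₁ → term k ≈ 0#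
      term≈0 k k<p₁ = trans (*-congˡ (*-δ-≢ _ (ℕ.<⇒≢ (ℕ.≤-<-trans y≤m m<m*[p∸[1+k]])))) (zeroʳ _)
        where
        1<p∸[1+k] : 1 < p ∸ suc k
        1<p∸[1+k] = ≡.subst (1 <_) (≡.sym (ℕ.+-∸-assoc 1 (ℕ.<⇒≤ k<p₁))) (s≤s (ℕ.m<n⇒0<n∸m k<p₁))
        m<m*[p∸[1+k]] : m < m ℕ.* (p ∸ suc k)
        m<m*[p∸[1+k]] = ℕ.m<m*n m (p ∸ suc k) {{ℕ.>-nonZero 0<m}} 1<p∸[1+k]

    open Trinomial 0<m 0<M κ (Δt K p r f cf) Δt-trunc

    powzₘ : ℕ → H K
    powzₘ t = powH K p r f cf (z K m) t

    record zₘ^_≈_·z_ (t : ℕ) (γ : Carrier) (s : ℕ) : Set ℓ where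
      constructor pointwise
      field at : ∀ i → i < N → powzₘ t i ≈ γ * z K s i
    open zₘ^_≈_·z_ public

    zₘ^-cong : ∀ {t t' γ γ' s s'} → t ≡ t' → γ ≈ γ' → s ≡ s' → zₘ^ t ≈ γ ·z s → zₘ^ t' ≈ γ' ·z s'
    zₘ^-cong ≡.refl γ≈γ' ≡.refl h = pointwise λ i i<N → trans (at h i i<N) (*-congʳ γ≈γ')

    zₘ^0 : zₘ^ 0 ≈ 1# ·z 0
    zₘ^0 = pointwise λ i _ → sym (*-identityˡ _)

    zₘ^suc : ∀ {t γ s} → zₘ^ t ≈ γ ·z s → s < N → ∀ i → powzₘ (suc t) i ≈ Δpow K p r f cf i s m * γ
    zₘ^suc {t} {γ} {s} h s<N i = begin
      Σ< K N (λ a → Σ< K N (λ b → X a b * (powzₘ t a * δ K b m)))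
        ≈⟨ Σ<-cong N (λ a _ → trans (Σ<-cong N λ b _ → sym (*-assoc _ _ _)) (Σ<-δ N (λ b → X a b * powzₘ t a) m<N)) ⟩
      Σ< K N (λ a → X a m * powzₘ t a)
        ≈⟨ Σ<-cong N (λ a a<N → trans (*-congˡ (at h a a<N)) (sym (*-assoc _ _ _))) ⟩
      Σ< K N (λ a → (X a m * γ) * δ K a s)
        ≈⟨ Σ<-δ N (λ a → X a m * γ) s<N ⟩
      X s m * γ ∎
      where
      X : ℕ → ℕ → Carrier
      X = Δpow K p r f cf i

    zₘ^-step-within : ∀ {t γ} q k → q < m → suc k < p →
      zₘ^ t ≈ γ ·z (q ℕ.+ k ℕ.* m) → zₘ^ suc t ≈ (γ * fromℕ K (suc k)) ·z (q ℕ.+ suc k ℕ.* m)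
    zₘ^-step-within {t} {γ} q k q<m 1+k<p h = pointwise coefficient
      where
      s s' : ℕ
      s = q ℕ.+ k ℕ.* m
      s' = q ℕ.+ suc k ℕ.* m
      s+m≡s' : s ℕ.+ m ≡ s'
      s+m≡s' = ≡.trans (ℕ.+-assoc q (k ℕ.* m) m) (≡.cong (q ℕ.+_) (ℕ.+-comm (k ℕ.* m) m))
      s<M : s < M
      s<M = ℕ.<-≤-trans (ℕ.+-monoˡ-< (k ℕ.* m) q<m)
                        (≡.subst (suc k ℕ.* m ≤_) (ℕ.*-comm (suc p₁) m) (ℕ.*-monoˡ-≤ m (ℕ.≤-pred 1+k<p)))
      s<N : s < N
      s<N = ℕ.<-trans s<M (≡.subst (M <_) M+m≡N (ℕ.m<m+n M 0<m))
      i·δ[1+s,M+i]≈0 : ∀ i → fromℕ K i * δ K (suc s) (M ℕ.+ i) ≈ 0#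
      i·δ[1+s,M+i]≈0 zero    = zeroˡ _
      i·δ[1+s,M+i]≈0 (suc i) = *-δ-≢ _ (ℕ.<⇒≢ (ℕ.≤-<-trans s<M (≡.subst (M <_) (≡.sym (ℕ.+-suc M i)) (s≤s (ℕ.m≤m+n M i)))))
      coefficient : ∀ i → i < N → powzₘ (suc t) i ≈ γ * fromℕ K (suc k) * z K s' i
      coefficient i i<N = begin
        powzₘ (suc t) i
          ≈⟨ trans (zₘ^suc {t} h s<N i) (*-congʳ (powAA-at-m i s)) ⟩
        (fromℕ K (i C m) * δ K (s ℕ.+ m) i + κ * (fromℕ K i * δ K (suc s) (M ℕ.+ i))) * γ
          ≈⟨ *-congʳ (trans (+-congˡ (trans (*-congˡ (i·δ[1+s,M+i]≈0 i)) (zeroʳ κ))) (+-identityʳ _)) ⟩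
        fromℕ K (i C m) * δ K (s ℕ.+ m) i * γ
          ≈⟨ *-congʳ (trans (*-congˡ (δ-cong (λ e → ≡.trans (≡.sym e) s+m≡s') (λ e → ≡.trans s+m≡s' (≡.sym e))))
                            (*-δ-congʳ {i} {s'} λ { ≡.refl → fromℕ-[q+j*p^e]Cp^e p-prime char-p r (suc k) q q<m })) ⟩
        fromℕ K (suc k) * δ K i s' * γ
          ≈⟨ solve 3 (λ x d c → x :* d :* c := c :* x :* d) refl _ _ _ ⟩
        γ * fromℕ K (suc k) * δ K i s' ∎

    zₘ^-step-across : ∀ {t γ} q → q < m → zₘ^ t ≈ γ ·z (q ℕ.+ M) → zₘ^ suc t ≈ (γ * (κ * fromℕ K (suc q))) ·z (suc q)
    zₘ^-step-across {t} {γ} q q<m h = pointwise coefficient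
      where
      s : ℕ
      s = q ℕ.+ M
      s<N : s < N
      s<N = ≡.subst (s <_) M+m≡N (≡.subst (_< M ℕ.+ m) (ℕ.+-comm M q) (ℕ.+-monoʳ-< M q<m))
      N≤s+m : N ≤ s ℕ.+ m
      N≤s+m = ≡.subst (_≤ s ℕ.+ m) M+m≡N (ℕ.+-monoˡ-≤ m (ℕ.m≤n+m M q))
      1+s≡M+[1+q] : suc s ≡ M ℕ.+ suc q
      1+s≡M+[1+q] = ≡.trans (≡.cong suc (ℕ.+-comm q M)) (≡.sym (ℕ.+-suc M q))
      coefficient : ∀ i → i < N → powzₘ (suc t) i ≈ γ * (κ * fromℕ K (suc q)) * z K (suc q) i
      coefficient i i<N = begin
        powzₘ (suc t) i
          ≈⟨ trans (zₘ^suc {t} h s<N i) (*-congʳ (powAA-at-m i s)) ⟩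
        (fromℕ K (i C m) * δ K (s ℕ.+ m) i + κ * (fromℕ K i * δ K (suc s) (M ℕ.+ i))) * γ
          ≈⟨ *-congʳ (trans (+-congʳ (*-δ-≢ _ λ s+m≡i → ℕ.<⇒≱ i<N (≡.subst (N ≤_) s+m≡i N≤s+m))) (+-identityˡ _)) ⟩
        κ * (fromℕ K i * δ K (suc s) (M ℕ.+ i)) * γ
          ≈⟨ *-congʳ (*-congˡ (trans (*-congˡ (δ-cong to from)) (*-δ-congʳ {i} {suc q} (λ e → reflexive (≡.cong (fromℕ K) e))))) ⟩
        κ * (fromℕ K (suc q) * δ K i (suc q)) * γ
          ≈⟨ solve 4 (λ k x d c → k :* (x :* d) :* c := c :* (k :* x) :* d) refl _ _ _ _ ⟩
        γ * (κ * fromℕ K (suc q)) * δ K i (suc q) ∎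
        where
        to : suc s ≡ M ℕ.+ i → i ≡ suc q
        to e = ℕ.+-cancelˡ-≡ M i (suc q) (≡.trans (≡.sym e) 1+s≡M+[1+q])
        from : i ≡ suc q → suc s ≡ M ℕ.+ i
        from ≡.refl = 1+s≡M+[1+q]

    zₘ^-within-block : ∀ {t γ} q → q < m → zₘ^ t ≈ γ ·z q →
      ∀ k → k < p → zₘ^ (k ℕ.+ t) ≈ (γ * fromℕ K (k !)) ·z (q ℕ.+ k ℕ.* m)
    zₘ^-within-block q q<m h zero _ =
      zₘ^-cong ≡.refl (sym (trans (*-congˡ (+-identityʳ 1#)) (*-identityʳ _))) (≡.sym (ℕ.+-identityʳ q)) h
    zₘ^-within-block {t} {γ} q q<m h (suc k) 1+k<p =
      zₘ^-cong ≡.refl γk!·[1+k]≈γ[1+k]! ≡.refl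
        (zₘ^-step-within {k ℕ.+ t} q k q<m 1+k<p (zₘ^-within-block q q<m h k (ℕ.<-trans (ℕ.n<1+n k) 1+k<p)))
      where
      γk!·[1+k]≈γ[1+k]! : γ * fromℕ K (k !) * fromℕ K (suc k) ≈ γ * fromℕ K (suc k !)
      γk!·[1+k]≈γ[1+k]! = trans (trans (*-assoc _ _ _) (*-congˡ (*-comm _ _))) (*-congˡ (sym (fromℕ-* (suc k) (k !))))

    zₘ^-block : ∀ {t γ} q → q < m → zₘ^ t ≈ γ ·z q → zₘ^ (p ℕ.+ t) ≈ (γ * (f * fromℕ K (suc q))) ·z (suc q)
    zₘ^-block {t} {γ} q q<m h =
      zₘ^-cong ≡.refl constant ≡.refl
        (zₘ^-step-across {suc p₁ ℕ.+ t} q q<m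
          (zₘ^-cong ≡.refl refl (≡.cong (q ℕ.+_) (ℕ.*-comm (suc p₁) m))
            (zₘ^-within-block q q<m h (suc p₁) (ℕ.n<1+n (suc p₁)))))
      where
      constant : γ * fromℕ K (suc p₁ !) * (κ * fromℕ K (suc q)) ≈ γ * (f * fromℕ K (suc q))
      constant = begin
        γ * fromℕ K (suc p₁ !) * (f * cf (suc p₁) * fromℕ K (suc q))
          ≈⟨ solve 5 (λ g F f c S → g :* F :* (f :* c :* S) := g :* (f :* S) :* (c :* F)) refl _ _ _ _ _ ⟩
        γ * (f * fromℕ K (suc q)) * (cf (suc p₁) * fromℕ K (suc p₁ !))
          ≈⟨ trans (*-congˡ cf-top) (*-identityʳ _) ⟩
        γ * (f * fromℕ K (suc q)) ∎

    zₘ^[q*p] : ∀ q → q < p → Σ Carrier λ γ → zₘ^ (q ℕ.* p) ≈ γ ·z q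
    zₘ^[q*p] zero    _     = 1# , zₘ^0
    zₘ^[q*p] (suc q) 1+q<p with zₘ^[q*p] q (ℕ.<-trans (ℕ.n<1+n q) 1+q<p)
    ... | γ , h = _ , zₘ^-block q (ℕ.<-≤-trans (ℕ.<-trans (ℕ.n<1+n q) 1+q<p) p≤m) h

    zₘ^p : zₘ^ p ≈ f ·z 1
    zₘ^p = zₘ^-cong (ℕ.+-identityʳ p) (trans (*-identityˡ _) (trans (*-congˡ (+-identityʳ 1#)) (*-identityʳ f))) ≡.refl
      (zₘ^-block 0 0<m zₘ^0)

    zₘ^p² : zₘ^ (p ^ 2) ≈ 0# ·z p
    zₘ^p² = zₘ^-cong (≡.cong (p ℕ.*_) (≡.sym (ℕ.*-identityʳ p))) γf·p≈0 ≡.refl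
      (zₘ^-block (suc p₁) (ℕ.<-≤-trans (ℕ.n<1+n (suc p₁)) p≤m) (proj₂ last-block))
      where
      last-block : Σ Carrier λ γ → zₘ^ (suc p₁ ℕ.* p) ≈ γ ·z suc p₁
      last-block = zₘ^[q*p] (suc p₁) (ℕ.n<1+n (suc p₁))
      γf·p≈0 : proj₁ last-block * (f * fromℕ K p) ≈ 0#
      γf·p≈0 = trans (*-congˡ (trans (*-congˡ char-p) (zeroʳ f))) (zeroʳ _)

open import Data.Nat using (_*_)

lemma5p5 : ∀ {c ℓ} (K : CommutativeRing c ℓ) → IsField K →
    (p : ℕ) → Prime p → HasChar K p →
    (n : ℕ) → 2 ≤ n →
    (f : CommutativeRing.Carrier K) → ¬ (CommutativeRing._≈_ K f (CommutativeRing.0# K)) →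
    (cf : ℕ → CommutativeRing.Carrier K) →
    (∀ l → 1 ≤ l → l ≤ p ∸ 1 →
      CommutativeRing._≈_ K
        (CommutativeRing._*_ K (cf l) (fromℕ K (l ! * (p ∸ l) !)))
        (CommutativeRing.1# K)) →
    (∀ i → i < p ^ n →
      CommutativeRing._≈_ K
        (powH K p (n ∸ 1) f cf (z K (p ^ (n ∸ 1))) p i)
        (CommutativeRing._*_ K f (z K 1 i)))
    × (∀ i → i < p ^ n →
      CommutativeRing._≈_ K
        (powH K p (n ∸ 1) f cf (z K (p ^ (n ∸ 1))) (p ^ 2) i)
        (CommutativeRing.0# K))
lemma5p5 K _ 0 p-prime = ⊥-elim (ℕ.NonTrivial.nonTrivial (prime⇒nonTrivial p-prime))
lemma5p5 K _ 1 p-prime = ⊥-elim (ℕ.NonTrivial.nonTrivial (prime⇒nonTrivial p-prime))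
lemma5p5 K _ (suc (suc p₁)) p-prime char-p (suc (suc r₁)) (s≤s (s≤s _)) f _ cf cf-inv =
  zₘ^p .at , λ i i<N → trans (zₘ^p² .at i i<N) (zeroˡ _)
  where
  open CommutativeRing K using (trans; reflexive; *-congˡ; zeroˡ)
  [1+p₁]!*[p∸[1+p₁]]!≡[1+p₁]! : suc p₁ ! * (suc (suc p₁) ∸ suc p₁) ! ≡ suc p₁ !
  [1+p₁]!*[p∸[1+p₁]]!≡[1+p₁]! = ≡.trans (≡.cong (λ k → suc p₁ ! * k !) (ℕ.m+n∸n≡m 1 (suc p₁))) (ℕ.*-identityʳ _)
  open PowersOfZ K p₁ r₁ f cf p-prime char-p
    (trans (*-congˡ (reflexive (≡.cong (fromℕ K) (≡.sym [1+p₁]!*[p∸[1+p₁]]!≡[1+p₁]!))))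
           (cf-inv (suc p₁) (s≤s z≤n) ℕ.≤-refl))
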